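{- Let $(V,E)$ be an interval graph with representation $(L,<_L,f_L,f_R)$ and let $v_0\,E\,\cdots E\,v_n$ be a minimal path with $F(v_0)<_L F(v_n)$. Then: (i) $f_R(v_i)<_L f_R(v_{i+1})$ for each $i<n-1$, and $f_L(v_j)<_L f_L(v_{j+1})$ for each $j$ with $0<j<n$; (ii) if $v\in V$ and $F(v)<_L F(v_0)$, then $\neg\,v_i\,E\,v$ for every $i\neq 1$; symmetrically, if $F(v_n)<_L F(v)$, then $\neg\,v_i\,E\,v$ for every $i\neq n-1$.
   Context: An interval graph with representation $(L,<_L,f_L,f_R)$ is a reflexive graph $(V,E)$ with $E$ symmetric together with a linear order $(L,<_L)$ and maps $f_L,f_R\colon V\to L$ with $f_L(v)\le_L f_R(v)$ such that, with $F(v)=\{\ell\mid f_L(v)\le_L\ell\le_L f_R(v)\}$, $v\,E\,u\iff F(v)\cap F(u)\neq\emptyset$. $F(x)<_L F(y)$ means $f_R(x)<_L f_L(y)$. A path $v_0\,E\,v_1\,E\cdots E\,v_n$ is minimal if $\neg\,v_i\,E\,v_j$ for all $i,j$ with $i+1<j\le n$. -}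

module Defs where

open import Level using (Level; _⊔_; suc)
open import Data.Nat using (ℕ; _<_; _≤_)
open import Data.Product using (Σ; ∃; _×_; _,_)
open import Data.Sum using (_⊎_)
open import Relation.Nullary using (¬_)
open import Relation.Binary.PropositionalEquality using (_≡_)
open import Relation.Binary.Structures using (IsStrictTotalOrder)

_≤[_]_ : ∀ {l r} {L : Set l} → L → (L → L → Set r) → L → Set (l ⊔ r)
x ≤[ _<_ ] y = (x < y) ⊎ (x ≡ y)

record IntervalGraph {v e l r : Level} (V : Set v) (E : V → V → Set e)
                     (L : Set l) (_<L_ : L → L → Set r)
                     (fL fR : V → L) : Set (v ⊔ e ⊔ l ⊔ suc r) where
  field
    linear    : IsStrictTotalOrder _≡_ _<L_
    reflexive : ∀ x → E x x
    symmetric : ∀ x y → E x y → E y x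
    fL≤fR     : ∀ x → fL x ≤[ _<L_ ] fR x
    -- x E y iff F(x) ∩ F(y) ≠ ∅, where F(x) = { ℓ | fL x ≤ ℓ ≤ fR x }
    edge⇔     : ∀ x y →
      (E x y → ∃ λ ℓ → ((fL x ≤[ _<L_ ] ℓ) × (ℓ ≤[ _<L_ ] fR x))
                     × ((fL y ≤[ _<L_ ] ℓ) × (ℓ ≤[ _<L_ ] fR y)))
      × ((∃ λ ℓ → ((fL x ≤[ _<L_ ] ℓ) × (ℓ ≤[ _<L_ ] fR x))
                × ((fL y ≤[ _<L_ ] ℓ) × (ℓ ≤[ _<L_ ] fR y))) → E x y)

-- F(x) <_L F(y) means f_R(x) <_L f_L(y).
IntervalBefore : ∀ {v l r} {V : Set v} {L : Set l} → (L → L → Set r) →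
                 (V → L) → (V → L) → V → V → Set r
IntervalBefore _<L_ fL fR x y = fR x <L fL y

-- p 0 E p 1 E ... E p n is a path (only indices ≤ n matter).
IsPath : ∀ {v e} {V : Set v} → (V → V → Set e) → ℕ → (ℕ → V) → Set e
IsPath E n p = ∀ i → i < n → E (p i) (p (ℕ.suc i))

IsMinimalPath : ∀ {v e} {V : Set v} → (V → V → Set e) → ℕ → (ℕ → V) → Set e
IsMinimalPath E n p =
  IsPath E n p × (∀ i j → ℕ.suc i < j → j ≤ n → ¬ E (p i) (p j))

{-# OPTIONS --safe #-}
-- Non-adjacent vertices have disjoint intervals, so one lies entirely before the
-- other.  If x ≺ u and y is a neighbour of x not adjacent to u, then y ≺ u, since
-- u ≺ y would put F(u) between the overlapping intervals F(x) and F(y).  Pushing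
-- p 0 ≺ p n forward along the minimal path gives p i ≺ p n, and pulling that back
-- from the end gives p i ≺ p j whenever i + 2 ≤ j.  Both parts follow from this
-- ordering together with the overlap fL (p (i + 1)) ≤ fR (p i) of consecutive intervals.
module Submission where

open import Defs
open import Level using (Level; _⊔_)
open import Data.Nat using (ℕ; zero; suc; _<_; _≤_; _∸_; _+_; s≤s; z≤n)
open import Data.Nat.Properties using (≤-refl; ≤-trans; n≤1+n; m≤n+m; +-suc; m∸n+n≡m; m≤n⇒m<n∨m≡n)
open import Data.Product using (_×_; _,_; proj₁; proj₂)
open import Data.Sum using (_⊎_; inj₁; inj₂)
open import Function using (_∘_)
open import Relation.Nullary using (¬_; yes; no; contradiction)
open import Relation.Binary.PropositionalEquality using (_≡_; _≢_; refl; sym; trans; subst)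
open import Relation.Binary.Definitions using (tri<; tri≈; tri>)
open import Relation.Binary.Structures using (IsStrictTotalOrder)
import Relation.Binary.Construct.StrictToNonStrict as StrictToNonStrict

module IntervalGraphProperties
    {v e l r : Level} {V : Set v} {E : V → V → Set e}
    {L : Set l} {_<L_ : L → L → Set r} {fL fR : V → L}
    (G : IntervalGraph V E L _<L_ fL fR) where

  open IntervalGraph G
  open IsStrictTotalOrder linear
    using (isEquivalence; compare; irrefl; _<?_; <-resp-≈; <-respʳ-≈; <-respˡ-≈)
    renaming (trans to <-trans)
  open StrictToNonStrict _≡_ _<L_ using (total)
    renaming (trans to ≤-trans′; <-≤-trans to <-≤-trans′; ≤-<-trans to ≤-<-trans′)

  _≤L_ : L → L → Set (l ⊔ r)
  a ≤L b = a ≤[ _<L_ ] b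

  _≺_ : V → V → Set r
  _≺_ = IntervalBefore _<L_ fL fR

  ≤L-trans : ∀ {a b c} → a ≤L b → b ≤L c → a ≤L c
  ≤L-trans = ≤-trans′ isEquivalence <-resp-≈ <-trans

  <-≤-trans : ∀ {a b c} → a <L b → b ≤L c → a <L c
  <-≤-trans = <-≤-trans′ <-trans <-respʳ-≈

  ≤-<-trans : ∀ {a b c} → a ≤L b → b <L c → a <L c
  ≤-<-trans = ≤-<-trans′ sym <-trans <-respˡ-≈

  ≮⇒≥ : ∀ {a b} → ¬ (a <L b) → b ≤L a
  ≮⇒≥ {a} {b} a≮b with compare a b
  ... | tri< a<b _ _ = contradiction a<b a≮b
  ... | tri≈ _ a≡b _ = inj₂ (sym a≡b)
  ... | tri> _ _ b<a = inj₁ b<a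

  ≺-trans : ∀ {x y z} → x ≺ y → y ≺ z → x ≺ z
  ≺-trans {y = y} x≺y y≺z = <-trans x≺y (≤-<-trans (fL≤fR y) y≺z)

  edge⇒fL≤fR : ∀ {x y} → E x y → fL y ≤L fR x
  edge⇒fL≤fR {x} {y} x~y with proj₁ (edge⇔ x y) x~y
  ... | _ , (_ , ℓ≤fRx) , (fLy≤ℓ , _) = ≤L-trans fLy≤ℓ ℓ≤fRx

  ≺⇒≁ : ∀ {x y} → x ≺ y → ¬ E x y
  ≺⇒≁ x≺y x~y = irrefl refl (<-≤-trans x≺y (edge⇒fL≤fR x~y))

  ≻⇒≁ : ∀ {x y} → y ≺ x → ¬ E x y
  ≻⇒≁ y≺x = ≺⇒≁ y≺x ∘ symmetric _ _

  overlap⇒edge : ∀ {x y} → fL y ≤L fR x → fL x ≤L fR y → E x y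
  overlap⇒edge {x} {y} fLy≤fRx fLx≤fRy with total compare (fL x) (fL y)
  ... | inj₁ fLx≤fLy = proj₂ (edge⇔ x y) (fL y , (fLx≤fLy , fLy≤fRx) , (inj₂ refl , fL≤fR y))
  ... | inj₂ fLy≤fLx = proj₂ (edge⇔ x y) (fL x , (inj₂ refl , fL≤fR x) , (fLy≤fLx , fLx≤fRy))

  ≁⇒≺⊎≻ : ∀ {x y} → ¬ E x y → x ≺ y ⊎ y ≺ x
  ≁⇒≺⊎≻ {x} {y} x≁y with fR x <? fL y | fR y <? fL x
  ... | yes x≺y | _       = inj₁ x≺y
  ... | no _    | yes y≺x = inj₂ y≺x
  ... | no x⊀y  | no y⊀x  = contradiction (overlap⇒edge (≮⇒≥ x⊀y) (≮⇒≥ y⊀x)) x≁y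

  neighbour-≺ : ∀ {x y u} → x ≺ u → E x y → ¬ E y u → y ≺ u
  neighbour-≺ x≺u x~y y≁u with ≁⇒≺⊎≻ y≁u
  ... | inj₁ y≺u = y≺u
  ... | inj₂ u≺y = contradiction x~y (≺⇒≁ (≺-trans x≺u u≺y))

  ≺-neighbour : ∀ {x y u} → u ≺ x → E x y → ¬ E y u → u ≺ y
  ≺-neighbour u≺x x~y y≁u with ≁⇒≺⊎≻ y≁u
  ... | inj₁ y≺u = contradiction x~y (≻⇒≁ (≺-trans y≺u u≺x))
  ... | inj₂ u≺y = u≺y

  module MinimalPath (n : ℕ) (p : ℕ → V) (minimal : IsMinimalPath E n p)
                     (p₀≺pₙ : p 0 ≺ p n) where

    edge : ∀ i → i < n → E (p i) (p (suc i))
    edge = proj₁ minimal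

    chordless : ∀ i j → suc i < j → j ≤ n → ¬ E (p i) (p j)
    chordless = proj₂ minimal

    ≺-last : ∀ i → suc (suc i) ≤ n → p i ≺ p n
    ≺-last zero    _   = p₀≺pₙ
    ≺-last (suc i) i+3≤n = neighbour-≺ (≺-last i i+2≤n) (edge i (≤-trans (n≤1+n _) i+2≤n))
                                       (chordless (suc i) n i+3≤n ≤-refl)
      where i+2≤n = ≤-trans (n≤1+n _) i+3≤n

    ≺-nonadjacent : ∀ i j → suc (suc i) ≤ j → j ≤ n → p i ≺ p j
    ≺-nonadjacent i j i+2≤j j≤n = ≺-nonadjacent′ (n ∸ j) j i+2≤j (m∸n+n≡m j≤n)
      where
      ≺-nonadjacent′ : ∀ m j → suc (suc i) ≤ j → m + j ≡ n → p i ≺ p j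
      ≺-nonadjacent′ zero    j i+2≤j refl = ≺-last i i+2≤j
      ≺-nonadjacent′ (suc m) j i+2≤j m+1+j≡n =
        ≺-neighbour (≺-nonadjacent′ m (suc j) (≤-trans i+2≤j (n≤1+n j)) (trans (+-suc m j) m+1+j≡n))
                    (symmetric _ _ (edge j j<n))
                    (chordless i j i+2≤j (≤-trans (n≤1+n j) j<n) ∘ symmetric _ _)
        where j<n = subst (suc j ≤_) m+1+j≡n (s≤s (m≤n+m j m))

    fR-increasing : ∀ i → suc i < n → fR (p i) <L fR (p (suc i))
    fR-increasing i i+2≤n =
      <-≤-trans (≺-nonadjacent i (suc (suc i)) ≤-refl i+2≤n) (edge⇒fL≤fR (edge (suc i) i+2≤n))

    fL-increasing : ∀ j → 0 < j → j < n → fL (p j) <L fL (p (suc j))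
    fL-increasing (suc j) _ j+2≤n =
      ≤-<-trans (edge⇒fL≤fR (edge j (≤-trans (n≤1+n _) j+2≤n)))
                (≺-nonadjacent j (suc (suc j)) ≤-refl j+2≤n)

    ≁-before-first : ∀ w → w ≺ p 0 → ∀ i → i ≤ n → i ≢ 1 → ¬ E (p i) w
    ≁-before-first w w≺p₀ zero          _   _   = ≻⇒≁ w≺p₀
    ≁-before-first w w≺p₀ (suc zero)    _   i≢1 = contradiction refl i≢1
    ≁-before-first w w≺p₀ (suc (suc i)) i≤n _   =
      ≻⇒≁ (≺-trans w≺p₀ (≺-nonadjacent 0 (suc (suc i)) (s≤s (s≤s z≤n)) i≤n))

    ≁-after-last : ∀ w → p n ≺ w → ∀ i → i ≤ n → i ≢ n ∸ 1 → ¬ E (p i) w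
    ≁-after-last w pₙ≺w i i≤n i≢n-1 with m≤n⇒m<n∨m≡n i≤n
    ... | inj₂ refl = ≺⇒≁ pₙ≺w
    ... | inj₁ i<n with m≤n⇒m<n∨m≡n i<n
    ...   | inj₂ refl  = contradiction refl i≢n-1
    ...   | inj₁ i+2≤n = ≺⇒≁ (≺-trans (≺-last i i+2≤n) pₙ≺w)

mainTheorem4 : ∀ {v e l r : Level} {V : Set v} {E : V → V → Set e}
    {L : Set l} {_<L_ : L → L → Set r} {fL fR : V → L} →
    IntervalGraph V E L _<L_ fL fR →
    (n : ℕ) (p : ℕ → V) →
    IsMinimalPath E n p →
    IntervalBefore _<L_ fL fR (p 0) (p n) →
    -- (i)
    ((∀ i → suc i < n → fR (p i) <L fR (p (suc i)))
     × (∀ j → 0 < j → j < n → fL (p j) <L fL (p (suc j))))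
    -- (ii)
    × ((∀ w → IntervalBefore _<L_ fL fR w (p 0) →
          ∀ i → i ≤ n → i ≢ 1 → ¬ E (p i) w)
       × (∀ w → IntervalBefore _<L_ fL fR (p n) w →
          ∀ i → i ≤ n → i ≢ n ∸ 1 → ¬ E (p i) w))
mainTheorem4 G n p minimal p₀≺pₙ =
  (fR-increasing , fL-increasing) , (≁-before-first , ≁-after-last)
  where open IntervalGraphProperties.MinimalPath G n p minimal p₀≺pₙ
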